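{- Let $w$ be a word of length $n$ and $1\le i\le n$ with $\mathsf{LSF}_\ell[i]>0$, and let $j=\mathsf{LSF}_r[i]$. Suppose $\mathsf{LSF}_\ell[i]\ge \mathsf{LUF}[j]$. Then $\mathsf{LUF}[i]=H(j)-i$ if $i<H(j)$, and $\mathsf{LUF}[i]=\mathsf{LUF}[j]$ otherwise.
   Context: For a word $w=w[1]\cdots w[n]$, $w[i\mathinner{.\,.} j]$ denotes the factor $w[i]\cdots w[j]$ (empty if $j<i$). A border of a word $x$ is a (possibly empty) word $u\neq x$ that is both a prefix and a suffix of $x$; $x$ is unbordered if its only border is the empty word. $\mathsf{LUF}[i]$ is the length of the longest unbordered prefix of $w[i\mathinner{.\,.} n]$. The longest successor factor array is defined by $\mathsf{LSF}_\ell[n]=0$ and, for $i<n$, $\mathsf{LSF}_\ell[i]=\max\{k\ge 0 : w[i\mathinner{.\,.} i+k-1]=w[j\mathinner{.\,.} j+k-1]\text{ for some } j \text{ with } i<j\le n\}$. If $\mathsf{LSF}_\ell[i]>0$, $\mathsf{LSF}_r[i]=\max\{j : i<j\le n,\ w[j\mathinner{.\,.} j+\mathsf{LSF}_\ell[i]-1]=w[i\mathinner{.\,.} i+\mathsf{LSF}_\ell[i]-1]\}$. The hook $H(j)$ of a position $j$ is the smallest position $q\le j$ such that $w[q\mathinner{.\,.} j-1]$ can be written as a concatenation (possibly empty) of words each of which is an unbordered non-empty prefix of $w[j\mathinner{.\,.} n]$. -}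

module Defs where

open import Data.Nat using (ℕ; _≤_; _<_; _∸_; _+_)
open import Data.List using (List; []; _++_; take; drop; length; concat)
open import Data.List.Relation.Unary.All using (All)
open import Data.Product using (_×_; ∃; ∃-syntax)
open import Data.Sum using (_⊎_)
open import Relation.Binary.PropositionalEquality using (_≡_; _≢_)

-- Words are lists over an arbitrary alphabet A; positions are 1-based.

module _ {A : Set} where

  IsPrefix : List A → List A → Set
  IsPrefix u x = ∃[ v ] (u ++ v ≡ x)

  IsSuffix : List A → List A → Set
  IsSuffix u x = ∃[ v ] (v ++ u ≡ x)

  Border : List A → List A → Set
  Border u x = u ≢ x × IsPrefix u x × IsSuffix u x

  Unbordered : List A → Set
  Unbordered x = ∀ u → Border u x → u ≡ []

  suffixFrom : List A → ℕ → List A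
  suffixFrom w i = drop (i ∸ 1) w

  -- w[i .. i+k-1]  (1-based; truncated at the end of w)
  factor : List A → ℕ → ℕ → List A
  factor w i k = take k (suffixFrom w i)

  IsLUF : List A → ℕ → ℕ → Set
  IsLUF w i m =
    m ≤ length (suffixFrom w i) × Unbordered (take m (suffixFrom w i)) ×
    (∀ k → k ≤ length (suffixFrom w i) → Unbordered (take k (suffixFrom w i)) → k ≤ m)

  -- w[i .. i+k-1] = w[j .. j+k-1] (both factors must lie inside w;
  -- for i < j this is forced by equality of the truncated lists)
  Occ : List A → ℕ → ℕ → ℕ → Set
  Occ w i j k = k + j ∸ 1 ≤ length w × factor w i k ≡ factor w j k

  IsLSFℓ : List A → ℕ → ℕ → Set
  IsLSFℓ w i L =
    (i ≡ length w × L ≡ 0) ⊎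
    (i < length w ×
      (∃[ j ] (i < j × j ≤ length w × Occ w i j L)) ×
      (∀ k j → i < j → j ≤ length w → Occ w i j k → k ≤ L))

  IsLSFr : List A → ℕ → ℕ → ℕ → Set
  IsLSFr w i L j =
    (i < j × j ≤ length w × Occ w i j L) ×
    (∀ j' → i < j' → j' ≤ length w → Occ w i j' L → j' ≤ j)

  Decomp : List A → ℕ → ℕ → Set
  Decomp w j q =
    ∃[ us ] (All (λ u → u ≢ [] × Unbordered u × IsPrefix u (suffixFrom w j)) us ×
             concat us ≡ factor w q (j ∸ q))

  IsHook : List A → ℕ → ℕ → Set
  IsHook w j h =
    (1 ≤ h × h ≤ j × Decomp w j h) ×
    (∀ q → 1 ≤ q → q ≤ j → Decomp w j q → h ≤ q)

-- Let v = w[i..n] and u = w[j..n]. Since LUF[j] ≤ LSF_ℓ[i], every unbordered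
-- prefix of u is also a prefix of v. Key observation: if x is nonempty, z is a
-- nonempty prefix of u and x·z is a prefix of v, then x·z is bordered, because
-- a shortest nonempty word that is both a prefix and a suffix of z is
-- unbordered, hence a prefix of v, hence a border of x·z.
-- By definition of the hook, w[H(j)..n] = u₁⋯u_k·u with every u_t an unbordered
-- prefix of u, so every nonempty prefix of w[H(j)..n] ends in a nonempty prefix
-- of u. If i < H(j), every prefix of v longer than R = w[i..H(j)-1] is therefore
-- bordered, while R itself is unbordered: an unbordered border c of R reoccurs
-- inside R, so |c| ≤ LSF_ℓ[i], so c is a prefix of u and c·u₁⋯u_k is a hook
-- decomposition starting before H(j). If H(j) ≤ i, then v starts inside some
-- u_t, whose length is at most LUF[j], and every prefix of v longer than LUF[j]
-- is bordered by the same observation.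

module Submission where

open import Defs
open import Data.Nat using (ℕ; zero; suc; _≤_; _<_; _∸_; _+_; z≤n; s≤s; s≤s⁻¹)
open import Data.Nat.Properties
open import Data.List using (List; []; _∷_; length; _++_; take; drop; concat)
open import Data.List.Properties
  using (length-++; length-++-≤ˡ; length-++-≤ʳ; length-take; length-drop; take++drop≡id;
         take-take; drop-drop; drop-all; ++-assoc; ++-identityʳ; ++-cancelʳ; ++-conicalˡ;
         ∷-injectiveˡ; ∷-injectiveʳ)
open import Data.List.Relation.Unary.All using (All; []; _∷_)
open import Data.Product using (_×_; _,_; proj₂; ∃₂; ∃-syntax)
open import Data.Sum using (_⊎_; inj₁; inj₂)
open import Data.Empty using (⊥; ⊥-elim)
open import Function using (_∘_)
open import Relation.Nullary using (¬_)
open import Relation.Binary.PropositionalEquality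

module _ {A : Set} where

  shorter⇒≢ : ∀ {x y : List A} → length x < length y → x ≢ y
  shorter⇒≢ lt refl = <-irrefl refl lt

  length-<-++ : ∀ {x : List A} (z : List A) → x ≢ [] → length z < length (x ++ z)
  length-<-++ {[]}    _ x≢[] = ⊥-elim (x≢[] refl)
  length-<-++ {_ ∷ x} z _    = s≤s (length-++-≤ʳ z {x})

  length-take-≤ : ∀ {m} {x : List A} → m ≤ length x → length (take m x) ≡ m
  length-take-≤ {m} {x} m≤ = trans (length-take m x) (m≤n⇒m⊓n≡m m≤)

  drop-length-++ : ∀ (x y : List A) → drop (length x) (x ++ y) ≡ y
  drop-length-++ []      y = refl
  drop-length-++ (_ ∷ x) y = drop-length-++ x y

  take-take-≤ : ∀ {m n} (x : List A) → m ≤ n → take m (take n x) ≡ take m x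
  take-take-≤ {m} {n} x m≤n = trans (take-take m n x) (cong (λ k → take k x) (m≤n⇒m⊓n≡m m≤n))

  ++-equidivisible : ∀ (a b c d : List A) → a ++ b ≡ c ++ d →
    (∃[ m ] (c ≡ a ++ m × b ≡ m ++ d)) ⊎ (∃[ m ] (m ≢ [] × a ≡ c ++ m × d ≡ m ++ b))
  ++-equidivisible []      b c       d eq = inj₁ (c , refl , eq)
  ++-equidivisible (x ∷ a) b []      d eq = inj₂ (x ∷ a , (λ ()) , refl , sym eq)
  ++-equidivisible (x ∷ a) b (y ∷ c) d eq
    with ∷-injectiveˡ eq | ++-equidivisible a b c d (∷-injectiveʳ eq)
  ... | refl | inj₁ (m , c≡ , b≡)        = inj₁ (m , cong (x ∷_) c≡ , b≡)
  ... | refl | inj₂ (m , m≢[] , a≡ , d≡) = inj₂ (m , m≢[] , cong (x ∷_) a≡ , d≡)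

  prefix-trans : ∀ {a b c : List A} → IsPrefix a b → IsPrefix b c → IsPrefix a c
  prefix-trans {a} (r , refl) (s , refl) = r ++ s , sym (++-assoc a r s)

  suffix-trans : ∀ {a b c : List A} → IsSuffix a b → IsSuffix b c → IsSuffix a c
  suffix-trans {a} (r , refl) (s , refl) = s ++ r , ++-assoc s r a

  prefix-length : ∀ {b x : List A} → IsPrefix b x → length b ≤ length x
  prefix-length {b} (_ , refl) = length-++-≤ˡ b

  proper-prefix-shorter : ∀ {b x : List A} → b ≢ x → IsPrefix b x → length b < length x
  proper-prefix-shorter {b} b≢x ([] , refl) = ⊥-elim (b≢x (sym (++-identityʳ b)))
  proper-prefix-shorter {b} _ (_ ∷ _ , refl) =
    subst (length b <_) (sym (length-++ b)) (m<m+n (length b) (s≤s z≤n))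

  take-prefix : ∀ n (x : List A) → IsPrefix (take n x) x
  take-prefix n x = drop n x , take++drop≡id n x

  prefix-take : ∀ {b x : List A} → IsPrefix b x → take (length b) x ≡ b
  prefix-take {[]}    _          = refl
  prefix-take {c ∷ b} (r , refl) = cong (c ∷_) (prefix-take (r , refl))

  take-length≡⇒prefix : ∀ {b y : List A} → take (length b) y ≡ b → IsPrefix b y
  take-length≡⇒prefix {b} {y} eq = subst (λ z → IsPrefix z y) eq (take-prefix (length b) y)

  prefix-of-prefix : ∀ {b y x : List A} →
    IsPrefix b x → IsPrefix y x → length b ≤ length y → IsPrefix b y
  prefix-of-prefix {b} {y} {x} b⊑x y⊑x |b|≤|y| = take-length≡⇒prefix (begin
    take (length b) y                   ≡⟨ cong (take (length b)) (sym (prefix-take y⊑x)) ⟩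
    take (length b) (take (length y) x) ≡⟨ take-take-≤ x |b|≤|y| ⟩
    take (length b) x                   ≡⟨ prefix-take b⊑x ⟩
    b                                   ∎)
    where open ≡-Reasoning

  prefix-transfer : ∀ {L} {b x y : List A} →
    take L x ≡ take L y → IsPrefix b x → length b ≤ L → IsPrefix b y
  prefix-transfer {L} {b} {x} {y} agree b⊑x |b|≤L = take-length≡⇒prefix (begin
    take (length b) y            ≡⟨ sym (take-take-≤ y |b|≤L) ⟩
    take (length b) (take L y)   ≡⟨ cong (take (length b)) (sym agree) ⟩
    take (length b) (take L x)   ≡⟨ take-take-≤ x |b|≤L ⟩
    take (length b) x            ≡⟨ prefix-take b⊑x ⟩
    b                            ∎)
    where open ≡-Reasoning

  ¬¬-unbordered-prefix-suffix : ∀ (z : List A) → z ≢ [] →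
    ¬ ¬ (∃[ c ] (c ≢ [] × Unbordered c × IsPrefix c z × IsSuffix c z))
  ¬¬-unbordered-prefix-suffix z = go (length z) z ≤-refl
    where
    -- z itself qualifies unless it has a nonempty border, which is shorter.
    go : ∀ n (z : List A) → length z ≤ n → z ≢ [] →
      ¬ ¬ (∃[ c ] (c ≢ [] × Unbordered c × IsPrefix c z × IsSuffix c z))
    go zero    []      _ z≢[] _ = z≢[] refl
    go zero    (_ ∷ _) () _ _
    go (suc n) z |z|≤ z≢[] none = none (z , z≢[] , z-unbordered , ([] , ++-identityʳ z) , ([] , refl))
      where
      z-unbordered : Unbordered z
      z-unbordered []          _                 = refl
      z-unbordered b@(_ ∷ _) (b≢z , b⊑z , b⊒z) =
        ⊥-elim (go n b (s≤s⁻¹ (<-≤-trans (proper-prefix-shorter b≢z b⊑z) |z|≤)) (λ ())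
          λ (c , c≢[] , c-unb , c⊑b , c⊒b) →
            none (c , c≢[] , c-unb , prefix-trans c⊑b b⊑z , suffix-trans c⊒b b⊒z))

  unbordered-if-no-unbordered-border : ∀ (z : List A) →
    (∀ c → c ≢ [] → Unbordered c → Border c z → ⊥) → Unbordered z
  unbordered-if-no-unbordered-border z none []          _                 = refl
  unbordered-if-no-unbordered-border z none b@(_ ∷ _) (b≢z , b⊑z , b⊒z) =
    ⊥-elim (¬¬-unbordered-prefix-suffix b (λ ()) λ (c , c≢[] , c-unb , c⊑b , c⊒b) →
      none c c≢[] c-unb
        ( shorter⇒≢ (≤-<-trans (prefix-length c⊑b) (proper-prefix-shorter b≢z b⊑z))
        , prefix-trans c⊑b b⊑z , suffix-trans c⊒b b⊒z))

  Piece : List A → List A → Set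
  Piece u x = x ≢ [] × Unbordered x × IsPrefix x u

  nonempty-prefix-ends-in-prefix : ∀ {u : List A} us → All (Piece u) us →
    ∀ {p} → p ≢ [] → IsPrefix p (concat us ++ u) →
    ∃₂ λ x z → p ≡ x ++ z × z ≢ [] × IsPrefix z u
  nonempty-prefix-ends-in-prefix []       []         p≢[] p⊑u     = [] , _ , refl , p≢[] , p⊑u
  nonempty-prefix-ends-in-prefix {u} (x ∷ us) ((_ , _ , x⊑u) ∷ pieces) {p} p≢[] (r , eq)
    with ++-equidivisible p r x (concat us ++ u) (trans eq (++-assoc x (concat us) u))
  ... | inj₁ (m , refl , _) = [] , p , refl , p≢[] , prefix-trans (m , refl) x⊑u
  ... | inj₂ (m , m≢[] , refl , rest≡)
    with nonempty-prefix-ends-in-prefix us pieces m≢[] (r , sym rest≡)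
  ...   | y , z , refl , z≢[] , z⊑u = x ++ y , z , sym (++-assoc x y z) , z≢[] , z⊑u

module _ {A : Set} {u v : List A} (shared : ∀ {b} → IsPrefix b u → Unbordered b → IsPrefix b v) where

  bordered-ending-in-prefix : ∀ {x z : List A} → x ≢ [] → z ≢ [] →
    IsPrefix z u → IsPrefix (x ++ z) v → ¬ Unbordered (x ++ z)
  bordered-ending-in-prefix {x} {z} x≢[] z≢[] z⊑u xz⊑v xz-unb =
    ¬¬-unbordered-prefix-suffix z z≢[] λ (c , c≢[] , c-unb , c⊑z , c⊒z) →
      let |c|<|xz| = ≤-<-trans (prefix-length c⊑z) (length-<-++ z x≢[])
          c⊑v = shared (prefix-trans c⊑z z⊑u) c-unb
      in c≢[] (xz-unb c ( shorter⇒≢ |c|<|xz|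
                        , prefix-of-prefix c⊑v xz⊑v (<⇒≤ |c|<|xz|)
                        , suffix-trans c⊒z (x , refl)))

  bordered-past-nonempty : ∀ {x p : List A} {us} → All (Piece u) us → x ≢ [] →
    v ≡ x ++ (concat us ++ u) → IsPrefix p v → length x < length p → ¬ Unbordered p
  bordered-past-nonempty {x} {p} {us} pieces x≢[] v≡ (r , p++r≡v) |x|<|p| p-unb
    with ++-equidivisible p r x (concat us ++ u) (trans p++r≡v v≡)
  ... | inj₁ (m , refl , _) = <⇒≱ |x|<|p| (length-++-≤ˡ p)
  ... | inj₂ (m , m≢[] , refl , rest≡)
    with nonempty-prefix-ends-in-prefix us pieces m≢[] (r , sym rest≡)
  ...   | y , z , refl , z≢[] , z⊑u =
    bordered-ending-in-prefix (x≢[] ∘ ++-conicalˡ x y) z≢[] z⊑u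
      (subst (λ q → IsPrefix q v) reassoc (r , p++r≡v)) (subst Unbordered reassoc p-unb)
    where
    reassoc : x ++ (y ++ z) ≡ (x ++ y) ++ z
    reassoc = sym (++-assoc x y z)

  bordered-long-prefix : ∀ {m} {pf p : List A} {us} →
    (∀ {b} → IsPrefix b u → Unbordered b → length b ≤ m) → All (Piece u) us →
    pf ++ v ≡ concat us ++ u → length u < length v →
    IsPrefix p v → m < length p → ¬ Unbordered p
  bordered-long-prefix {pf = pf} _ [] eq |u|<|v| _ _ _ =
    <⇒≱ |u|<|v| (≤-trans (length-++-≤ʳ v {pf}) (≤-reflexive (cong length eq)))
  bordered-long-prefix {pf = pf} {us = x ∷ us} short ((_ , x-unb , x⊑u) ∷ pieces) eq |u|<|v| p⊑v m<|p|
    with ++-equidivisible x (concat us ++ u) pf v (trans (sym (++-assoc x (concat us) u)) (sym eq))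
  ... | inj₁ (pf′ , refl , rest≡) = bordered-long-prefix short pieces (sym rest≡) |u|<|v| p⊑v m<|p|
  ... | inj₂ (r , r≢[] , refl , v≡) =
    bordered-past-nonempty pieces r≢[] v≡ p⊑v
      (≤-<-trans (≤-trans (length-++-≤ʳ r {pf}) (short x⊑u x-unb)) m<|p|)

-- Indices below are 0-based: i stands for the position suc i of the paper.
module _ {A : Set} (w : List A) where

  take-++-drop : ∀ {p q} → p ≤ q → take (q ∸ p) (drop p w) ++ drop q w ≡ drop p w
  take-++-drop {p} {q} p≤q = begin
    take (q ∸ p) (drop p w) ++ drop q w                ≡⟨ cong (take (q ∸ p) (drop p w) ++_) drop-q ⟩
    take (q ∸ p) (drop p w) ++ drop (q ∸ p) (drop p w) ≡⟨ take++drop≡id (q ∸ p) (drop p w) ⟩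
    drop p w                                           ∎
    where
    open ≡-Reasoning
    drop-q : drop q w ≡ drop (q ∸ p) (drop p w)
    drop-q = sym (trans (drop-drop p (q ∸ p) w) (cong (λ k → drop k w) (m+[n∸m]≡n p≤q)))

  drop-+-length : ∀ {a} {x y : List A} → drop a w ≡ x ++ y → drop (a + length x) w ≡ y
  drop-+-length {a} {x} {y} eq = begin
    drop (a + length x) w         ≡⟨ sym (drop-drop a (length x) w) ⟩
    drop (length x) (drop a w)    ≡⟨ cong (drop (length x)) eq ⟩
    drop (length x) (x ++ y)      ≡⟨ drop-length-++ x y ⟩
    y                             ∎
    where open ≡-Reasoning

  drop≡++⇒< : ∀ {a b} {c : List A} → c ≢ [] → drop a w ≡ c ++ drop b w → a < b
  drop≡++⇒< {a} {b} {c} c≢[] eq = ≰⇒> λ b≤a → <⇒≱ longer (shorter b≤a)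
    where
    longer : length (drop b w) < length (drop a w)
    longer = subst (length (drop b w) <_) (cong length (sym eq)) (length-<-++ (drop b w) c≢[])
    shorter : b ≤ a → length (drop a w) ≤ length (drop b w)
    shorter b≤a = subst₂ _≤_ (sym (length-drop a w)) (sym (length-drop b w)) (∸-monoʳ-≤ (length w) b≤a)

  occurrence : ∀ {a b} {x : List A} → x ≢ [] →
    IsPrefix x (drop a w) → IsPrefix x (drop b w) → Occ w (suc a) (suc b) (length x)
  occurrence {a} {b} {x} x≢[] x⊑a x⊑b = fits , trans (prefix-take x⊑a) (sym (prefix-take x⊑b))
    where
    b<n : b < length w
    b<n = ≰⇒> λ n≤b → x≢[] (++-conicalˡ x _ (trans (proj₂ x⊑b) (drop-all b w n≤b)))
    fits : length x + suc b ∸ 1 ≤ length w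
    fits = begin
      length x + suc b ∸ 1 ≡⟨ cong (_∸ 1) (+-suc (length x) b) ⟩
      length x + b         ≤⟨ +-monoˡ-≤ b (subst (length x ≤_) (length-drop b w) (prefix-length x⊑b)) ⟩
      length w ∸ b + b     ≡⟨ m∸n+n≡m (<⇒≤ b<n) ⟩
      length w             ∎
      where open ≤-Reasoning

  decomp-intro : ∀ {q p us} → q ≤ p → All (Piece (drop p w)) us →
    drop q w ≡ concat us ++ drop p w → Decomp w (suc p) (suc q)
  decomp-intro {q} {p} {us} q≤p pieces eq =
    us , pieces , sym (++-cancelʳ (drop p w) _ _ (trans (take-++-drop q≤p) eq))

  decomp-elim : ∀ {q p} → q ≤ p → Decomp w (suc p) (suc q) →
    ∃[ us ] (All (Piece (drop p w)) us × drop q w ≡ concat us ++ drop p w)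
  decomp-elim {q} {p} q≤p (us , pieces , eq) =
    us , pieces , trans (sym (take-++-drop q≤p)) (cong (_++ drop p w) (sym eq))

  IsLUF-max : ∀ i {m} {b : List A} → IsLUF w i m →
    IsPrefix b (suffixFrom w i) → Unbordered b → length b ≤ m
  IsLUF-max _ (_ , _ , max) b⊑ b-unb =
    max _ (prefix-length b⊑) (subst Unbordered (sym (prefix-take b⊑)) b-unb)

  IsLUF-≡-length : ∀ i {m} {x : List A} → IsLUF w i m →
    IsPrefix x (suffixFrom w i) → Unbordered x →
    (∀ {p} → IsPrefix p (suffixFrom w i) → length x < length p → ¬ Unbordered p) → m ≡ length x
  IsLUF-≡-length i {m} {x} luf@(m≤ , m-unb , _) x⊑ x-unb longer-bordered =
    ≤-antisym (≮⇒≥ |x|≮m) (IsLUF-max i luf x⊑ x-unb)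
    where
    |x|≮m : ¬ length x < m
    |x|≮m |x|<m = longer-bordered (take-prefix m _)
      (subst (length x <_) (sym (length-take-≤ m≤)) |x|<m) m-unb

module _ {A : Set} (w : List A) {i j h : ℕ} {us : List (List A)}
  (pieces : All (Piece (drop j w)) us) (hook-suffix : drop h w ≡ concat us ++ drop j w)
  (shared : ∀ {b} → IsPrefix b (drop j w) → Unbordered b → IsPrefix b (drop i w)) where

  LUF-after-hook : h ≤ i → i < j → j ≤ length w → ∀ {m mi} →
    IsLUF w (suc j) m → IsLUF w (suc i) mi → mi ≡ m
  LUF-after-hook h≤i i<j j≤n {m} lufj@(m≤|u| , m-unb , _) lufi =
    trans (IsLUF-≡-length w (suc i) lufi (shared (take-prefix m (drop j w)) m-unb) m-unb
            λ p⊑v |x|<|p| → bordered-long-prefix shared (IsLUF-max w (suc j) lufj) pieces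
              (trans (take-++-drop w h≤i) hook-suffix) |u|<|v| p⊑v
              (subst (_< _) |x|≡m |x|<|p|))
          |x|≡m
    where
    |x|≡m : length (take m (drop j w)) ≡ m
    |x|≡m = length-take-≤ m≤|u|
    |u|<|v| : length (drop j w) < length (drop i w)
    |u|<|v| = subst₂ _<_ (sym (length-drop j w)) (sym (length-drop i w)) (∸-monoʳ-< i<j j≤n)

  before-hook-unbordered : i < h → h ≤ j → j < length w → ∀ {L} →
    take L (drop i w) ≡ take L (drop j w) →
    (∀ k q → suc i < q → q ≤ length w → Occ w (suc i) q k → k ≤ L) →
    (∀ q → 1 ≤ q → q ≤ suc j → Decomp w (suc j) q → suc h ≤ q) →
    Unbordered (take (h ∸ i) (drop i w))
  before-hook-unbordered i<h h≤j j<n {L} agree L-max hook-min =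
    unbordered-if-no-unbordered-border R no-border
    where
    R = take (h ∸ i) (drop i w)
    T = drop h w
    no-border : ∀ c → c ≢ [] → Unbordered c → Border c R → ⊥
    no-border c _    _     (c≢R , _ , []        , c≡R)    = c≢R c≡R
    no-border c c≢[] c-unb (_   , c⊑R , y@(_ ∷ _) , y++c≡R) =
      <⇒≱ a<h (s≤s⁻¹ (hook-min (suc a) (s≤s z≤n) (s≤s (<⇒≤ (<-≤-trans a<h h≤j))) a-decomp))
      where
      open ≡-Reasoning
      a = i + length y
      drop-a : drop a w ≡ c ++ T
      drop-a = drop-+-length w {i} {y} (begin
        drop i w       ≡⟨ sym (take-++-drop w (<⇒≤ i<h)) ⟩
        R ++ T         ≡⟨ cong (_++ T) (sym y++c≡R) ⟩
        (y ++ c) ++ T  ≡⟨ ++-assoc y c T ⟩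
        y ++ (c ++ T)  ∎)
      a<h : a < h
      a<h = drop≡++⇒< w c≢[] drop-a
      c⊑v : IsPrefix c (drop i w)
      c⊑v = prefix-trans c⊑R (take-prefix (h ∸ i) (drop i w))
      |c|≤L : length c ≤ L
      |c|≤L = L-max (length c) (suc a) (s≤s (m<m+n i (s≤s z≤n)))
        (<-≤-trans a<h (≤-trans h≤j (<⇒≤ j<n))) (occurrence w {i} c≢[] c⊑v (T , sym drop-a))
      a-decomp : Decomp w (suc j) (suc a)
      a-decomp = decomp-intro w (<⇒≤ (<-≤-trans a<h h≤j))
        ((c≢[] , c-unb , prefix-transfer agree c⊑v |c|≤L) ∷ pieces)
        (trans drop-a (trans (cong (c ++_) hook-suffix) (sym (++-assoc c (concat us) (drop j w)))))

  LUF-before-hook : i < h → h ≤ j → j < length w → ∀ {L mi} →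
    take L (drop i w) ≡ take L (drop j w) →
    (∀ k q → suc i < q → q ≤ length w → Occ w (suc i) q k → k ≤ L) →
    (∀ q → 1 ≤ q → q ≤ suc j → Decomp w (suc j) q → suc h ≤ q) →
    IsLUF w (suc i) mi → mi ≡ h ∸ i
  LUF-before-hook i<h h≤j j<n agree L-max hook-min lufi =
    trans (IsLUF-≡-length w (suc i) lufi (take-prefix (h ∸ i) (drop i w))
            (before-hook-unbordered i<h h≤j j<n agree L-max hook-min)
            (bordered-past-nonempty shared pieces R≢[] v≡))
          |R|≡h∸i
    where
    R = take (h ∸ i) (drop i w)
    |R|≡h∸i : length R ≡ h ∸ i
    |R|≡h∸i = length-take-≤ (subst (h ∸ i ≤_) (sym (length-drop i w))
      (∸-monoˡ-≤ i (≤-trans h≤j (<⇒≤ j<n))))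
    R≢[] : R ≢ []
    R≢[] R≡[] = m>n⇒m∸n≢0 i<h (trans (sym |R|≡h∸i) (cong length R≡[]))
    v≡ : drop i w ≡ R ++ (concat us ++ drop j w)
    v≡ = trans (sym (take-++-drop w (<⇒≤ i<h))) (cong (R ++_) hook-suffix)

IsLSFℓ-max : ∀ {A : Set} {w : List A} {i L} → IsLSFℓ w i L → 0 < L →
  ∀ k j → i < j → j ≤ length w → Occ w i j k → k ≤ L
IsLSFℓ-max (inj₁ (_ , refl)) ()
IsLSFℓ-max (inj₂ (_ , _ , max)) _ = max

lemma3 : {A : Set} (w : List A) (i L j h mi mj : ℕ) →
    1 ≤ i → i ≤ length w →
    IsLSFℓ w i L → 0 < L →
    IsLSFr w i L j →
    IsLUF w j mj → mj ≤ L →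
    IsHook w j h →
    IsLUF w i mi →
    (i < h → mi ≡ h ∸ i) × (¬ (i < h) → mi ≡ mj)
lemma3 w (suc i) L zero _ _ _ _ _ _ _ ((() , _) , _) _ _ _ _
lemma3 w (suc i) L (suc j) zero _ _ _ _ _ _ _ _ _ ((() , _) , _) _
lemma3 w (suc i) L (suc j) (suc h) mi mj _ _ lsfℓ 0<L ((i<j , j≤n , _ , agree) , _)
  lufj mj≤L ((_ , h≤j , h-decomp) , hook-min) lufi
  with decomp-elim w (s≤s⁻¹ h≤j) h-decomp
... | us , pieces , hook-suffix =
  (λ i<h → LUF-before-hook w pieces hook-suffix shared (s≤s⁻¹ i<h) (s≤s⁻¹ h≤j) j≤n
             agree (IsLSFℓ-max lsfℓ 0<L) hook-min lufi) ,
  (λ i≮h → LUF-after-hook w pieces hook-suffix shared (s≤s⁻¹ (≮⇒≥ i≮h)) (s≤s⁻¹ i<j)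
             (<⇒≤ j≤n) lufj lufi)
  where
  shared : ∀ {b} → IsPrefix b (drop j w) → Unbordered b → IsPrefix b (drop i w)
  shared b⊑u b-unb =
    prefix-transfer (sym agree) b⊑u (≤-trans (IsLUF-max w (suc j) lufj b⊑u b-unb) mj≤L)
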